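{- Let $n=4k+\alpha$ with $k$ a positive integer and $\alpha\in\{0,1,2,3\}$. Let $X_n=\{(x_1,x_2,x_3,x_4)\in\mathbb{Z}^4 : x_i\geq 1,\ x_1+x_2+x_3+x_4=n\}$, and define $f,g:X_n\to\mathbb{Z}$ by $$f(\mathbf{x})=n+(x_1+x_2)(x_3+x_4)+(x_1+x_4)(x_2+x_3)+\sum_{1\leq i<j<k\leq 4}x_ix_jx_k,\qquad g(\mathbf{x})=1+2n+\sum_{1\leq i<j\leq 4}x_ix_j,$$ and $D(\mathbf{x})=\sum_{i=1}^4|x_i-k|$. For $\mathbf{x}=(x_1,x_2,x_3,x_4)$ let $\sigma(\mathbf{x})=(x_1,x_2+1,x_3-1,x_4)$ and $\omega(\mathbf{x})=(x_1,x_2+1,x_3,x_4-1)$. If $\mathbf{x},\mathbf{y}\in X_n$ satisfy $D(\mathbf{y})=D(\mathbf{x})+2$ and either $\mathbf{y}=\sigma(\mathbf{x})$ or $\mathbf{y}=\omega(\mathbf{x})$, then $f(\mathbf{x})\geq f(\mathbf{y})$ and $g(\mathbf{x})\geq g(\mathbf{y})$.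
   Context: Here $f(\mathbf{x})$ and $g(\mathbf{x})$ are respectively the number of spanning trees and the number $N_{m-2}$ of connected spanning subgraphs with $m-2$ edges of the hamiltonian graph with $m=n+2$ edges obtained from the $n$-cycle by adding two crossing chords whose endpoints split the cycle into consecutive paths of lengths $x_1,x_2,x_3,x_4$. -}

module Defs where

open import Data.Integer using (ℤ; +_; _+_; _-_; _*_; ∣_∣; _≤_; _≥_)
open import Data.Nat using (ℕ)
open import Data.Product using (_×_; _,_)
open import Relation.Binary.PropositionalEquality using (_≡_)

Point : Set
Point = ℤ × ℤ × ℤ × ℤ

InX : ℕ → Point → Set
InX n (x₁ , x₂ , x₃ , x₄) =
  (x₁ ≥ + 1) × (x₂ ≥ + 1) × (x₃ ≥ + 1) × (x₄ ≥ + 1) ×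
  (x₁ + x₂ + x₃ + x₄ ≡ + n)

f : ℕ → Point → ℤ
f n (x₁ , x₂ , x₃ , x₄) =
  + n + (x₁ + x₂) * (x₃ + x₄) + (x₁ + x₄) * (x₂ + x₃)
  + (x₁ * x₂ * x₃ + x₁ * x₂ * x₄ + x₁ * x₃ * x₄ + x₂ * x₃ * x₄)

g : ℕ → Point → ℤ
g n (x₁ , x₂ , x₃ , x₄) =
  + 1 + + 2 * + n
  + (x₁ * x₂ + x₁ * x₃ + x₁ * x₄ + x₂ * x₃ + x₂ * x₄ + x₃ * x₄)

D : ℕ → Point → ℕ
D k (x₁ , x₂ , x₃ , x₄) =
  ∣ x₁ - + k ∣ Data.Nat.+ ∣ x₂ - + k ∣ Data.Nat.+ ∣ x₃ - + k ∣ Data.Nat.+ ∣ x₄ - + k ∣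

σ : Point → Point
σ (x₁ , x₂ , x₃ , x₄) = (x₁ , x₂ + + 1 , x₃ - + 1 , x₄)

ω : Point → Point
ω (x₁ , x₂ , x₃ , x₄) = (x₁ , x₂ + + 1 , x₃ , x₄ - + 1)

-- Raising x₂ by one and lowering x₃ (resp. x₄) by one changes each of the two
-- distances to k by at most one, so D grows by 2 only if the lowered coordinate
-- is at most k and x₂ is at least k; hence the lowered coordinate is at most x₂.
-- Expanding,
--   f x − f (σ x) = 2x₁ + 1 + (1 + x₁ + x₄)(x₂ − x₃),   g x − g (σ x) = x₂ − x₃ + 1,
--   f x − f (ω x) = (2 + x₁ + x₃)(x₂ − x₄ + 1),          g x − g (ω x) = x₂ − x₄ + 1,
-- all non-negative under these conditions.
module Submission where

open import Data.Product using (_×_; _,_; uncurry)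
open import Data.Sum using (_⊎_; inj₁; inj₂)
open import Relation.Binary.PropositionalEquality
  using (_≡_; refl; sym; trans; cong; cong₂; subst; module ≡-Reasoning)
open import Defs

module _ where
  open import Data.Nat
  open import Data.Nat.Properties
  open import Data.Nat.Tactic.RingSolver using (solve-∀)
  open import Relation.Nullary using (contradiction)

  m+n≡o+p⇒m≡o×n≡p : ∀ {m n o p} → m ≤ o → n ≤ p → m + n ≡ o + p → m ≡ o × n ≡ p
  m+n≡o+p⇒m≡o×n≡p {m} {n} m≤o n≤p eq with m≤n⇒m<n∨m≡n m≤o
  ... | inj₁ m<o  = contradiction eq (<⇒≢ (+-mono-<-≤ m<o n≤p))
  ... | inj₂ refl = refl , +-cancelˡ-≡ m n _ eq

  m+n+2≡[m+1]+[n+1] : ∀ m n → m + n + 2 ≡ (m + 1) + (n + 1)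
  m+n+2≡[m+1]+[n+1] = solve-∀

  m+n≡m+o+2⇒n≡o+2 : ∀ m {n o} → m + n ≡ m + o + 2 → n ≡ o + 2
  m+n≡m+o+2⇒n≡o+2 m {o = o} eq = +-cancelˡ-≡ m _ _ (trans eq (+-assoc m o 2))

  a+b+c+d≡[a+d]+[b+c] : ∀ a b c d → a + b + c + d ≡ (a + d) + (b + c)
  a+b+c+d≡[a+d]+[b+c] = solve-∀

  a+b+c+d≡[a+c]+[b+d] : ∀ a b c d → a + b + c + d ≡ (a + c) + (b + d)
  a+b+c+d≡[a+c]+[b+d] = solve-∀

module _ where
  open import Data.Integer
  open import Data.Integer.Properties
  open import Data.Integer.Tactic.RingSolver using (solve-∀)
  import Data.Nat as ℕ
  open import Data.Empty using (⊥-elim)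
  import Data.Nat.Properties as ℕ

  [i+j]-k≡[i-k]+j : ∀ i j k → (i + j) - k ≡ (i - k) + j
  [i+j]-k≡[i-k]+j = solve-∀

  ∣i+1∣≤∣i∣+1 : ∀ i → ∣ i + 1ℤ ∣ ℕ.≤ ∣ i ∣ ℕ.+ 1
  ∣i+1∣≤∣i∣+1 i = ∣i+j∣≤∣i∣+∣j∣ i 1ℤ

  ∣i-1∣≤∣i∣+1 : ∀ i → ∣ i - 1ℤ ∣ ℕ.≤ ∣ i ∣ ℕ.+ 1
  ∣i-1∣≤∣i∣+1 i = ∣i+j∣≤∣i∣+∣j∣ i (- 1ℤ)

  ∣i+1∣≡∣i∣+1⇒0≤i : ∀ i → ∣ i + 1ℤ ∣ ≡ ∣ i ∣ ℕ.+ 1 → 0ℤ ≤ i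
  ∣i+1∣≡∣i∣+1⇒0≤i (+ m)          _  = +≤+ ℕ.z≤n
  ∣i+1∣≡∣i∣+1⇒0≤i -[1+ 0 ]       ()
  ∣i+1∣≡∣i∣+1⇒0≤i -[1+ ℕ.suc m ] eq = ⊥-elim (ℕ.m≢1+m+n (ℕ.suc m) eq)

  ∣i-1∣≡∣i∣+1⇒i≤0 : ∀ i → ∣ i - 1ℤ ∣ ≡ ∣ i ∣ ℕ.+ 1 → i ≤ 0ℤ
  ∣i-1∣≡∣i∣+1⇒i≤0 +0       _  = +≤+ ℕ.z≤n
  ∣i-1∣≡∣i∣+1⇒i≤0 +[1+ m ] eq = ⊥-elim (ℕ.m≢1+m+n m eq)
  ∣i-1∣≡∣i∣+1⇒i≤0 -[1+ m ] _  = -≤+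

  1≤i⇒0≤i : ∀ {i} → 1ℤ ≤ i → 0ℤ ≤ i
  1≤i⇒0≤i = ≤-trans (+≤+ ℕ.z≤n)

  0≤i⇒0≤j⇒0≤i*j : ∀ {i j} → 0ℤ ≤ i → 0ℤ ≤ j → 0ℤ ≤ i * j
  0≤i⇒0≤j⇒0≤i*j {+ m} {+ n} _ _ = subst (0ℤ ≤_) (pos-* m n) (+≤+ ℕ.z≤n)

  distance-gain-2⇒straddle : ∀ b c k →
    ∣ (b + 1ℤ) - k ∣ ℕ.+ ∣ (c - 1ℤ) - k ∣ ≡ ∣ b - k ∣ ℕ.+ ∣ c - k ∣ ℕ.+ 2 →
    c ≤ k × k ≤ b
  distance-gain-2⇒straddle b c k gain
    with m+n≡o+p⇒m≡o×n≡p (∣i+1∣≤∣i∣+1 (b - k)) (∣i-1∣≤∣i∣+1 (c - k)) gain′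
    where
    open ≡-Reasoning
    gain′ : ∣ (b - k) + 1ℤ ∣ ℕ.+ ∣ (c - k) - 1ℤ ∣ ≡ (∣ b - k ∣ ℕ.+ 1) ℕ.+ (∣ c - k ∣ ℕ.+ 1)
    gain′ = begin
      ∣ (b - k) + 1ℤ ∣ ℕ.+ ∣ (c - k) - 1ℤ ∣
        ≡⟨ sym (cong₂ ℕ._+_ (cong ∣_∣ ([i+j]-k≡[i-k]+j b 1ℤ k))
                            (cong ∣_∣ ([i+j]-k≡[i-k]+j c (- 1ℤ) k))) ⟩
      ∣ (b + 1ℤ) - k ∣ ℕ.+ ∣ (c - 1ℤ) - k ∣ ≡⟨ gain ⟩
      ∣ b - k ∣ ℕ.+ ∣ c - k ∣ ℕ.+ 2          ≡⟨ m+n+2≡[m+1]+[n+1] ∣ b - k ∣ ∣ c - k ∣ ⟩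
      (∣ b - k ∣ ℕ.+ 1) ℕ.+ (∣ c - k ∣ ℕ.+ 1) ∎
  ... | b-gains , c-gains =
    i-j≤0⇒i≤j (∣i-1∣≡∣i∣+1⇒i≤0 (c - k) c-gains) , 0≤i-j⇒j≤i (∣i+1∣≡∣i∣+1⇒0≤i (b - k) b-gains)

  D-σ⇒x₃≤x₂ : ∀ k x₁ x₂ x₃ x₄ →
    D k (σ (x₁ , x₂ , x₃ , x₄)) ≡ D k (x₁ , x₂ , x₃ , x₄) ℕ.+ 2 → x₃ ≤ x₂
  D-σ⇒x₃≤x₂ k x₁ x₂ x₃ x₄ D≡ =
    uncurry ≤-trans (distance-gain-2⇒straddle x₂ x₃ (+ k)
      (m+n≡m+o+2⇒n≡o+2 (d₁ ℕ.+ d₄)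
        (trans (sym (a+b+c+d≡[a+d]+[b+c] d₁ _ _ d₄))
          (trans D≡ (cong (ℕ._+ 2) (a+b+c+d≡[a+d]+[b+c] d₁ _ _ d₄))))))
    where
    d₁ d₄ : ℕ.ℕ
    d₁ = ∣ x₁ - + k ∣
    d₄ = ∣ x₄ - + k ∣

  D-ω⇒x₄≤x₂ : ∀ k x₁ x₂ x₃ x₄ →
    D k (ω (x₁ , x₂ , x₃ , x₄)) ≡ D k (x₁ , x₂ , x₃ , x₄) ℕ.+ 2 → x₄ ≤ x₂
  D-ω⇒x₄≤x₂ k x₁ x₂ x₃ x₄ D≡ =
    uncurry ≤-trans (distance-gain-2⇒straddle x₂ x₄ (+ k)
      (m+n≡m+o+2⇒n≡o+2 (d₁ ℕ.+ d₃)
        (trans (sym (a+b+c+d≡[a+c]+[b+d] d₁ _ d₃ _))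
          (trans D≡ (cong (ℕ._+ 2) (a+b+c+d≡[a+c]+[b+d] d₁ _ d₃ _))))))
    where
    d₁ d₃ : ℕ.ℕ
    d₁ = ∣ x₁ - + k ∣
    d₃ = ∣ x₃ - + k ∣

  -- The polynomial bodies of f and g are restated so that the ring solver can see them.
  f-σ-gap : ∀ m x₁ x₂ x₃ x₄ →
    let F : ℤ → ℤ → ℤ → ℤ → ℤ
        F x₁ x₂ x₃ x₄ = m + (x₁ + x₂) * (x₃ + x₄) + (x₁ + x₄) * (x₂ + x₃)
                        + (x₁ * x₂ * x₃ + x₁ * x₂ * x₄ + x₁ * x₃ * x₄ + x₂ * x₃ * x₄)
    in F x₁ x₂ x₃ x₄ - F x₁ (x₂ + 1ℤ) (x₃ - 1ℤ) x₄
       ≡ (+ 2 * x₁ + 1ℤ) + (1ℤ + x₁ + x₄) * (x₂ - x₃)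
  f-σ-gap = solve-∀

  f-ω-gap : ∀ m x₁ x₂ x₃ x₄ →
    let F : ℤ → ℤ → ℤ → ℤ → ℤ
        F x₁ x₂ x₃ x₄ = m + (x₁ + x₂) * (x₃ + x₄) + (x₁ + x₄) * (x₂ + x₃)
                        + (x₁ * x₂ * x₃ + x₁ * x₂ * x₄ + x₁ * x₃ * x₄ + x₂ * x₃ * x₄)
    in F x₁ x₂ x₃ x₄ - F x₁ (x₂ + 1ℤ) x₃ (x₄ - 1ℤ)
       ≡ (+ 2 + x₁ + x₃) * ((x₂ - x₄) + 1ℤ)
  f-ω-gap = solve-∀

  g-σ-gap : ∀ m x₁ x₂ x₃ x₄ →
    let G : ℤ → ℤ → ℤ → ℤ → ℤ
        G x₁ x₂ x₃ x₄ = 1ℤ + + 2 * m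
                        + (x₁ * x₂ + x₁ * x₃ + x₁ * x₄ + x₂ * x₃ + x₂ * x₄ + x₃ * x₄)
    in G x₁ x₂ x₃ x₄ - G x₁ (x₂ + 1ℤ) (x₃ - 1ℤ) x₄ ≡ (x₂ - x₃) + 1ℤ
  g-σ-gap = solve-∀

  g-ω-gap : ∀ m x₁ x₂ x₃ x₄ →
    let G : ℤ → ℤ → ℤ → ℤ → ℤ
        G x₁ x₂ x₃ x₄ = 1ℤ + + 2 * m
                        + (x₁ * x₂ + x₁ * x₃ + x₁ * x₄ + x₂ * x₃ + x₂ * x₄ + x₃ * x₄)
    in G x₁ x₂ x₃ x₄ - G x₁ (x₂ + 1ℤ) x₃ (x₄ - 1ℤ) ≡ (x₂ - x₄) + 1ℤ
  g-ω-gap = solve-∀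

  i-j≡k⇒0≤k⇒j≤i : ∀ {i j k} → i - j ≡ k → 0ℤ ≤ k → j ≤ i
  i-j≡k⇒0≤k⇒j≤i refl 0≤k = 0≤i-j⇒j≤i 0≤k

  σ-decreases-f-g : ∀ n x₁ x₂ x₃ x₄ → 0ℤ ≤ x₁ → 0ℤ ≤ x₄ → x₃ ≤ x₂ →
    let x = (x₁ , x₂ , x₃ , x₄) in f n x ≥ f n (σ x) × g n x ≥ g n (σ x)
  σ-decreases-f-g n x₁ x₂ x₃ x₄ 0≤x₁ 0≤x₄ x₃≤x₂ =
    i-j≡k⇒0≤k⇒j≤i (f-σ-gap (+ n) x₁ x₂ x₃ x₄)
      (+-mono-≤ (+-mono-≤ (0≤i⇒0≤j⇒0≤i*j (nonNegative⁻¹ (+ 2)) 0≤x₁) (nonNegative⁻¹ 1ℤ))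
                (0≤i⇒0≤j⇒0≤i*j (+-mono-≤ (+-mono-≤ (nonNegative⁻¹ 1ℤ) 0≤x₁) 0≤x₄) 0≤x₂-x₃)) ,
    i-j≡k⇒0≤k⇒j≤i (g-σ-gap (+ n) x₁ x₂ x₃ x₄) (+-mono-≤ 0≤x₂-x₃ (nonNegative⁻¹ 1ℤ))
    where
    0≤x₂-x₃ : 0ℤ ≤ x₂ - x₃
    0≤x₂-x₃ = i≤j⇒0≤j-i x₃≤x₂

  ω-decreases-f-g : ∀ n x₁ x₂ x₃ x₄ → 0ℤ ≤ x₁ → 0ℤ ≤ x₃ → x₄ ≤ x₂ →
    let x = (x₁ , x₂ , x₃ , x₄) in f n x ≥ f n (ω x) × g n x ≥ g n (ω x)
  ω-decreases-f-g n x₁ x₂ x₃ x₄ 0≤x₁ 0≤x₃ x₄≤x₂ =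
    i-j≡k⇒0≤k⇒j≤i (f-ω-gap (+ n) x₁ x₂ x₃ x₄)
      (0≤i⇒0≤j⇒0≤i*j (+-mono-≤ (+-mono-≤ (nonNegative⁻¹ (+ 2)) 0≤x₁) 0≤x₃) 0≤x₂-x₄+1) ,
    i-j≡k⇒0≤k⇒j≤i (g-ω-gap (+ n) x₁ x₂ x₃ x₄) 0≤x₂-x₄+1
    where
    0≤x₂-x₄+1 : 0ℤ ≤ (x₂ - x₄) + 1ℤ
    0≤x₂-x₄+1 = +-mono-≤ (i≤j⇒0≤j-i x₄≤x₂) (nonNegative⁻¹ 1ℤ)

open import Data.Nat using (ℕ; _≤_; _*_; _+_)
open import Data.Integer using (_≥_)

lemma1 : (k α n : ℕ) → 1 ≤ k → α ≤ 3 → n ≡ 4 * k + α →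
         (x y : Point) → InX n x → InX n y →
         D k y ≡ D k x + 2 →
         (y ≡ σ x ⊎ y ≡ ω x) →
         (f n x ≥ f n y) × (g n x ≥ g n y)
lemma1 k _ n _ _ _ (x₁ , x₂ , x₃ , x₄) _ (1≤x₁ , _ , _ , 1≤x₄ , _) _ D≡ (inj₁ refl) =
  σ-decreases-f-g n x₁ x₂ x₃ x₄ (1≤i⇒0≤i 1≤x₁) (1≤i⇒0≤i 1≤x₄) (D-σ⇒x₃≤x₂ k x₁ x₂ x₃ x₄ D≡)
lemma1 k _ n _ _ _ (x₁ , x₂ , x₃ , x₄) _ (1≤x₁ , _ , 1≤x₃ , _ , _) _ D≡ (inj₂ refl) =
  ω-decreases-f-g n x₁ x₂ x₃ x₄ (1≤i⇒0≤i 1≤x₁) (1≤i⇒0≤i 1≤x₃) (D-ω⇒x₄≤x₂ k x₁ x₂ x₃ x₄ D≡)
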